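{- Let $n\in\mathbb{N}^+$ and let $M_n=(A,B,\lambda)$ be the shifted matching graph with $A=\{a_0,\dots,a_{n-1}\}$, $B=\{b_0,\dots,b_{n-1}\}$ and $\lambda(\{a_i,b_j\})=(j-i)\bmod n$. Then for all $i,j\in\{0,\dots,n-1\}$, $\mathrm{In}(\{a_i,b_j\})\cap\mathrm{Out}(\{a_i,b_j\})=\{a_i,b_j\}$.
   Context: $M_n$ is the complete bipartite graph with parts $A,B$ and the given labels. A path $v_1\dots v_k$ is temporal if $\lambda(\{v_i,v_{i+1}\})\le\lambda(\{v_{i+1},v_{i+2}\})$ for all $i\in[k-2]$. For a vertex $v$ and $t\in\mathbb{N}$, $\mathrm{In}_v(t)$ is the set of vertices reaching $v$ by a temporal path with all labels at most $t$, and $\mathrm{Out}_v(t)$ the set of vertices $v$ reaches by a temporal path with all labels at least $t$ (both contain $v$). For an edge $e=\{u,v\}$, $\mathrm{In}(e)=\mathrm{In}_u(\lambda(e))\cup\mathrm{In}_v(\lambda(e))$ and $\mathrm{Out}(e)=\mathrm{Out}_u(\lambda(e))\cup\mathrm{Out}_v(\lambda(e))$. -}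

module Defs where

open import Data.Nat using (ℕ; _+_; _∸_; _≤_; NonZero)
open import Data.Nat.DivMod using (_%_)
open import Data.Fin using (Fin; toℕ)
open import Data.Sum using (_⊎_; inj₁; inj₂)
open import Data.Product using (Σ; ∃; _×_; _,_)
open import Data.List using (List; []; _∷_)
open import Data.List.Relation.Unary.All using (All)
open import Data.List.Relation.Unary.Linked using (Linked)
open import Data.List.Relation.Unary.Unique.Propositional using (Unique)
open import Relation.Binary.PropositionalEquality using (_≡_)

V : ℕ → Set
V n = Fin n ⊎ Fin n

a : ∀ {n} → Fin n → V n
a = inj₁

b : ∀ {n} → Fin n → V n
b = inj₂

lab : ∀ {n} .{{_ : NonZero n}} → Fin n → Fin n → ℕ
lab {n} i j = (toℕ j + (n ∸ toℕ i)) % n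

data Edge {n : ℕ} .{{_ : NonZero n}} : V n → V n → ℕ → Set where
  ab : ∀ i j → Edge (a i) (b j) (lab i j)
  ba : ∀ i j → Edge (b j) (a i) (lab i j)

data Walk {n : ℕ} .{{_ : NonZero n}} : V n → V n → List ℕ → Set where
  [] : ∀ {u} → Walk u u []
  step : ∀ {u w v ℓ ls} → Edge u w ℓ → Walk w v ls → Walk u v (ℓ ∷ ls)

verts : ∀ {n} .{{_ : NonZero n}} {u v ls} → Walk {n} u v ls → List (V n)
verts {u = u} [] = u ∷ []
verts {u = u} (step e w) = u ∷ verts w

TemporalPath : ∀ {n} .{{_ : NonZero n}} → V n → V n → List ℕ → Set
TemporalPath u v ls = Σ (Walk u v ls) λ w → Unique (verts w) × Linked _≤_ ls

In : ∀ {n} .{{_ : NonZero n}} → V n → ℕ → V n → Set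
In v t x = ∃ λ ls → TemporalPath x v ls × All (_≤ t) ls

Out : ∀ {n} .{{_ : NonZero n}} → V n → ℕ → V n → Set
Out v t x = ∃ λ ls → TemporalPath v x ls × All (t ≤_) ls

InE : ∀ {n} .{{_ : NonZero n}} → Fin n → Fin n → V n → Set
InE i j x = In (a i) (lab i j) x ⊎ In (b j) (lab i j) x

OutE : ∀ {n} .{{_ : NonZero n}} → Fin n → Fin n → V n → Set
OutE i j x = Out (a i) (lab i j) x ⊎ Out (b j) (lab i j) x

module Submission where

-- Fix i and put r p = λ(a_i b_p) = (p - i) mod n, so r i = 0 and t = λ(e) = r j.  Since
-- r p + λ(a_p b_q) ≡ r q (mod n), the sum r p + λ(a_p b_q) is either r q or r q + n ("wraps").
-- On a temporal path into e with labels ≤ t no edge can wrap, so every vertex of In(e) has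
-- r ≤ t.  On a temporal path out of e with labels ≥ t, every b_q reached has r q ≥ t, and every
-- a_p reached other than a_i was entered through a wrapping edge, forcing r p > t.  As r is
-- injective, only a_i and b_j lie in both sets.

open import Defs
open import Data.Nat using (ℕ; NonZero; _+_; _∸_; _≤_; _<_; _<?_)
open import Data.Nat.Properties
open import Data.Nat.DivMod using (_%_; m%n<n; m<n⇒m%n≡m; [m+n]%n≡m%n; %-distribˡ-+; m%n%n≡m%n; n%n≡0)
open import Data.Nat.Solver using (module +-*-Solver)
open import Data.Fin using (Fin; toℕ)
open import Data.Fin.Properties using (toℕ<n; toℕ-injective)
open import Data.Sum as Sum using (_⊎_; inj₁; inj₂)
open import Data.Product using (_×_; _,_; ∃; uncurry)
open import Data.List using ([]; _∷_; head)
open import Data.Maybe using (fromMaybe)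
open import Data.List.Relation.Unary.All as All using (All; []; _∷_)
open import Data.List.Relation.Unary.Linked as Linked using (Linked; []; _∷_)
open import Data.List.Relation.Unary.Linked.Properties using (Linked⇒All)
import Data.List.Relation.Unary.AllPairs as AllPairs
open import Data.Empty using (⊥-elim)
open import Relation.Nullary using (yes; no)
open import Relation.Binary.PropositionalEquality

m<n+n⇒m%n≡m⊎m%n+n≡m : ∀ {m n} .{{_ : NonZero n}} → m < n + n → m % n ≡ m ⊎ m % n + n ≡ m
m<n+n⇒m%n≡m⊎m%n+n≡m {m} {n} m<n+n with m <? n
... | yes m<n = inj₁ (m<n⇒m%n≡m m<n)
... | no m≮n = inj₂ (begin
  m % n + n           ≡⟨ cong (λ k → k % n + n) restore ⟨
  (m ∸ n + n) % n + n ≡⟨ cong (_+ n) ([m+n]%n≡m%n (m ∸ n) n) ⟩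
  (m ∸ n) % n + n     ≡⟨ cong (_+ n) (m<n⇒m%n≡m m∸n<n) ⟩
  m ∸ n + n           ≡⟨ restore ⟩
  m                   ∎)
  where
  open ≡-Reasoning
  restore : m ∸ n + n ≡ m
  restore = m∸n+n≡m (≮⇒≥ m≮n)
  m∸n<n : m ∸ n < n
  m∸n<n = +-cancelʳ-< n (m ∸ n) n (subst (_< n + n) (sym restore) m<n+n)

[m%n+k]%n≡[m+k]%n : ∀ m k n .{{_ : NonZero n}} → (m % n + k) % n ≡ (m + k) % n
[m%n+k]%n≡[m+k]%n m k n = begin
  (m % n + k) % n           ≡⟨ %-distribˡ-+ (m % n) k n ⟩
  (m % n % n + k % n) % n   ≡⟨ cong (λ x → (x + k % n) % n) (m%n%n≡m%n m n) ⟩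
  (m % n + k % n) % n       ≡⟨ %-distribˡ-+ m k n ⟨
  (m + k) % n               ∎
  where open ≡-Reasoning

wrap⇒<ʳ : ∀ {m l k n} → m < n → m + l ≡ k + n → k < l
wrap⇒<ʳ {m} {l} {k} {n} m<n m+l≡k+n = +-cancelʳ-< n k l (begin-strict
  k + n ≡⟨ m+l≡k+n ⟨
  m + l <⟨ +-monoˡ-< l m<n ⟩
  n + l ≡⟨ +-comm n l ⟩
  l + n ∎)
  where open ≤-Reasoning

wrap⇒<ˡ : ∀ {m l k n} → l < n → m + l ≡ k + n → k < m
wrap⇒<ˡ {m} {l} l<n m+l≡k+n = wrap⇒<ʳ l<n (trans (+-comm l m) m+l≡k+n)

module _ {n : ℕ} .{{_ : NonZero n}} where

  lab<n : ∀ p q → lab p q < n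
  lab<n p q = m%n<n _ n

  lab-self : ∀ p → lab p p ≡ 0
  lab-self p = trans (cong (_% n) (m+[n∸m]≡n (<⇒≤ (toℕ<n p)))) (n%n≡0 n)

  [lab+toℕ]%n≡toℕ : ∀ p q → (lab p q + toℕ p) % n ≡ toℕ q
  [lab+toℕ]%n≡toℕ p q = begin
    (lab p q + toℕ p) % n              ≡⟨ [m%n+k]%n≡[m+k]%n (toℕ q + (n ∸ toℕ p)) (toℕ p) n ⟩
    (toℕ q + (n ∸ toℕ p) + toℕ p) % n  ≡⟨ cong (_% n) (+-assoc (toℕ q) _ _) ⟩
    (toℕ q + (n ∸ toℕ p + toℕ p)) % n  ≡⟨ cong (λ k → (toℕ q + k) % n) (m∸n+n≡m (<⇒≤ (toℕ<n p))) ⟩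
    (toℕ q + n) % n                    ≡⟨ [m+n]%n≡m%n (toℕ q) n ⟩
    toℕ q % n                          ≡⟨ m<n⇒m%n≡m (toℕ<n q) ⟩
    toℕ q                              ∎
    where open ≡-Reasoning

  lab-injectiveʳ : ∀ p {q r} → lab p q ≡ lab p r → q ≡ r
  lab-injectiveʳ p {q} {r} eq = toℕ-injective (begin
    toℕ q                 ≡⟨ [lab+toℕ]%n≡toℕ p q ⟨
    (lab p q + toℕ p) % n ≡⟨ cong (λ k → (k + toℕ p) % n) eq ⟩
    (lab p r + toℕ p) % n ≡⟨ [lab+toℕ]%n≡toℕ p r ⟩
    toℕ r                 ∎)
    where open ≡-Reasoning

  [lab+lab]%n≡lab : ∀ p q r → (lab p q + lab q r) % n ≡ lab p r
  [lab+lab]%n≡lab p q r = begin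
    (lab p q + lab q r) % n             ≡⟨ %-distribˡ-+ (Q + (n ∸ P)) (R + (n ∸ Q)) n ⟨
    ((Q + (n ∸ P)) + (R + (n ∸ Q))) % n ≡⟨ cong (_% n) (interchange Q (n ∸ P) R (n ∸ Q)) ⟩
    ((R + (n ∸ P)) + (Q + (n ∸ Q))) % n ≡⟨ cong (λ k → ((R + (n ∸ P)) + k) % n) (m+[n∸m]≡n (<⇒≤ (toℕ<n q))) ⟩
    ((R + (n ∸ P)) + n) % n             ≡⟨ [m+n]%n≡m%n (R + (n ∸ P)) n ⟩
    lab p r                             ∎
    where
    open ≡-Reasoning
    open +-*-Solver
    P Q R : ℕ
    P = toℕ p
    Q = toℕ q
    R = toℕ r
    interchange : ∀ w x y z → (w + x) + (y + z) ≡ (y + x) + (w + z)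
    interchange = solve 4 (λ w x y z → (w :+ x) :+ (y :+ z) := (y :+ x) :+ (w :+ z)) refl

  lab-cocycle : ∀ p q r → lab p q + lab q r ≡ lab p r ⊎ lab p q + lab q r ≡ lab p r + n
  lab-cocycle p q r =
    Sum.map (λ e → trans (sym e) ([lab+lab]%n≡lab p q r))
            (λ e → trans (sym e) (cong (_+ n) ([lab+lab]%n≡lab p q r)))
            (m<n+n⇒m%n≡m⊎m%n+n≡m (+-mono-< (lab<n p q) (lab<n q r)))

In-refl : ∀ {n} .{{_ : NonZero n}} (v : V n) t → In v t v
In-refl v t = [] , ([] , [] AllPairs.∷ AllPairs.[] , []) , []

Out-refl : ∀ {n} .{{_ : NonZero n}} (v : V n) t → Out v t v
Out-refl v t = [] , ([] , [] AllPairs.∷ AllPairs.[] , []) , []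

-- P x τ relates a vertex to the time τ at which a temporal path leaves it (for In)
-- or arrives at it (for Out); the path's end, resp. start, is taken to happen at time t.
module _ {n : ℕ} .{{_ : NonZero n}} (P : V n → ℕ → Set) where

  In-invariant : (∀ {u w ℓ τ} → Edge u w ℓ → P w τ → ℓ ≤ τ → P u ℓ) →
                 ∀ {v t x} → In v t x → P v t → ∃ (P x)
  In-invariant stable (_ , (walk , _ , linked) , bounded) Pv = _ , backward walk linked bounded Pv
    where
    ≤-departure : ∀ {ℓ ls t} → Linked _≤_ (ℓ ∷ ls) → All (_≤ t) (ℓ ∷ ls) → ℓ ≤ fromMaybe t (head ls)
    ≤-departure {ls = []}    _         (ℓ≤t ∷ []) = ℓ≤t
    ≤-departure {ls = _ ∷ _} (ℓ≤ℓ′ ∷ _) _          = ℓ≤ℓ′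

    backward : ∀ {x v t ls} → Walk x v ls → Linked _≤_ ls → All (_≤ t) ls → P v t →
               P x (fromMaybe t (head ls))
    backward []         _      _       Pv = Pv
    backward (step e w) linked bounded Pv =
      stable e (backward w (Linked.tail linked) (All.tail bounded) Pv) (≤-departure linked bounded)

  Out-invariant : (∀ {u w ℓ τ} → Edge u w ℓ → P u τ → τ ≤ ℓ → P w ℓ) →
                  ∀ {v t x} → Out v t x → P v t → ∃ (P x)
  Out-invariant stable (_ , (walk , _ , linked) , bounded) Pv = forward walk linked bounded Pv
    where
    forward : ∀ {u x τ ls} → Walk u x ls → Linked _≤_ ls → All (τ ≤_) ls → P u τ → ∃ (P x)
    forward []         _      _           Pu = _ , Pu
    forward (step e w) linked (τ≤ℓ ∷ _) Pu =
      forward w (Linked.tail linked) (All.tail (Linked⇒All ≤-trans ≤-refl linked)) (stable e Pu τ≤ℓ)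

module _ {n : ℕ} .{{_ : NonZero n}} (i j : Fin n) where

  private
    r : Fin n → ℕ
    r = lab i
    t : ℕ
    t = lab i j

  InInvariant : V n → ℕ → Set
  InInvariant (inj₁ p) τ = r p + τ ≤ t
  InInvariant (inj₂ q) τ = τ ≤ r q × r q ≤ t

  OutInvariant : V n → ℕ → Set
  OutInvariant (inj₁ p) τ = (r p ≡ 0 × t ≤ τ) ⊎ (t < r p × n + t ≤ r p + τ)
  OutInvariant (inj₂ q) τ = t ≤ r q × r q ≤ τ

  InInvariant-backward : ∀ {u w ℓ τ} → Edge u w ℓ → InInvariant w τ → ℓ ≤ τ → InInvariant u ℓ
  InInvariant-backward (ab p q) (τ≤rq , rq≤t) ℓ≤τ with lab-cocycle i p q
  ... | inj₁ e = subst (_≤ t) (sym e) rq≤t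
  ... | inj₂ e = ⊥-elim (<⇒≱ (wrap⇒<ʳ (lab<n i p) e) (≤-trans ℓ≤τ τ≤rq))
  InInvariant-backward (ba p q) rp+τ≤t ℓ≤τ
    with lab-cocycle i p q | ≤-trans (+-monoʳ-≤ (r p) ℓ≤τ) rp+τ≤t
  ... | inj₁ e | rp+ℓ≤t = subst (lab p q ≤_) e (m≤n+m (lab p q) (r p)) , subst (_≤ t) e rp+ℓ≤t
  ... | inj₂ e | rp+ℓ≤t = ⊥-elim (<⇒≱ (lab<n i j) (≤-trans (m≤n+m n (r q)) (subst (_≤ t) e rp+ℓ≤t)))

  OutInvariant-forward : ∀ {u w ℓ τ} → Edge u w ℓ → OutInvariant u τ → τ ≤ ℓ → OutInvariant w ℓ
  OutInvariant-forward (ab p q) (inj₁ (rp≡0 , t≤τ)) τ≤ℓ with lab-cocycle i p q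
  ... | inj₁ e = subst (t ≤_) (sym rq≡ℓ) (≤-trans t≤τ τ≤ℓ) , ≤-reflexive rq≡ℓ
    where
    rq≡ℓ : r q ≡ lab p q
    rq≡ℓ = trans (sym e) (cong (_+ lab p q) rp≡0)
  ... | inj₂ e = ⊥-elim (n≮0 (subst (r q <_) rp≡0 (wrap⇒<ˡ (lab<n p q) e)))
  OutInvariant-forward (ab p q) (inj₂ (t<rp , n+t≤rp+τ)) τ≤ℓ
    with lab-cocycle i p q | ≤-trans n+t≤rp+τ (+-monoʳ-≤ (r p) τ≤ℓ)
  ... | inj₁ e | n+t≤rp+ℓ =
    ⊥-elim (<⇒≱ (lab<n i q) (≤-trans (m≤m+n n t) (subst (n + t ≤_) e n+t≤rp+ℓ)))
  ... | inj₂ e | n+t≤rp+ℓ =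
    +-cancelˡ-≤ n t (r q) (subst (n + t ≤_) (trans e (+-comm (r q) n)) n+t≤rp+ℓ) ,
    <⇒≤ (wrap⇒<ʳ (lab<n i p) e)
  OutInvariant-forward (ba p q) (t≤rq , rq≤τ) τ≤ℓ with lab-cocycle i p q
  ... | inj₁ e =
    inj₁ (n≤0⇒n≡0 (+-cancelʳ-≤ (lab p q) (r p) 0 rp+ℓ≤ℓ) , ≤-trans (≤-trans t≤rq rq≤τ) τ≤ℓ)
    where
    rp+ℓ≤ℓ : r p + lab p q ≤ lab p q
    rp+ℓ≤ℓ = subst (_≤ lab p q) (sym e) (≤-trans rq≤τ τ≤ℓ)
  ... | inj₂ e = inj₂ (t<rp , subst (n + t ≤_) (trans (+-comm n (r q)) (sym e)) (+-monoʳ-≤ n t≤rq))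
    where
    t<rp : t < r p
    t<rp = ≤-<-trans t≤rq (wrap⇒<ˡ (lab<n p q) e)

  InE⇒InInvariant : ∀ {x} → InE i j x → ∃ (InInvariant x)
  InE⇒InInvariant (inj₁ h) =
    In-invariant InInvariant InInvariant-backward h (subst (λ k → k + t ≤ t) (sym (lab-self i)) ≤-refl)
  InE⇒InInvariant (inj₂ h) = In-invariant InInvariant InInvariant-backward h (≤-refl , ≤-refl)

  OutE⇒OutInvariant : ∀ {x} → OutE i j x → ∃ (OutInvariant x)
  OutE⇒OutInvariant (inj₁ h) =
    Out-invariant OutInvariant OutInvariant-forward h (inj₁ (lab-self i , ≤-refl))
  OutE⇒OutInvariant (inj₂ h) = Out-invariant OutInvariant OutInvariant-forward h (≤-refl , ≤-refl)

  InE∩OutE⇒endpoint : ∀ x → InE i j x → OutE i j x → x ≡ a i ⊎ x ≡ b j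
  InE∩OutE⇒endpoint (inj₁ p) inE outE with InE⇒InInvariant inE | OutE⇒OutInvariant outE
  ... | _ , _      | _ , inj₁ (rp≡0 , _) = inj₁ (cong a (lab-injectiveʳ i (trans rp≡0 (sym (lab-self i)))))
  ... | _ , rp+τ≤t | _ , inj₂ (t<rp , _) = ⊥-elim (<⇒≱ t<rp (m+n≤o⇒m≤o (r p) rp+τ≤t))
  InE∩OutE⇒endpoint (inj₂ q) inE outE with InE⇒InInvariant inE | OutE⇒OutInvariant outE
  ... | _ , (_ , rq≤t) | _ , (t≤rq , _) = inj₂ (cong b (lab-injectiveʳ i (≤-antisym rq≤t t≤rq)))

lemma33 : (n : ℕ) .{{_ : NonZero n}} (i j : Fin n) (x : V n)
          → ((InE i j x × OutE i j x) → (x ≡ a i ⊎ x ≡ b j))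
          × ((x ≡ a i ⊎ x ≡ b j) → (InE i j x × OutE i j x))
lemma33 n i j x = uncurry (InE∩OutE⇒endpoint i j x) , endpoint⇒InE×OutE
  where
  endpoint⇒InE×OutE : x ≡ a i ⊎ x ≡ b j → InE i j x × OutE i j x
  endpoint⇒InE×OutE (inj₁ refl) = inj₁ (In-refl x _) , inj₁ (Out-refl x _)
  endpoint⇒InE×OutE (inj₂ refl) = inj₂ (In-refl x _) , inj₂ (Out-refl x _)
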